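{- Let $f=(f_1,f_2,\dots)$ be a sequence of nonzero integers with $f_1=1$. For integers $m\ge1$ define the column sequence $C_m=(C_m(N))_{N\ge1}$ by $C_m(N)=\left[{N+m-1\atop m}\right]_f$, and for integers $M\ge0$ define the finite row sequence $R_M=(R_M(1),\dots,R_M(M+1))$ by $R_M(N)=\left[{M\atop N-1}\right]_f$. Then for all integers $m\ge1$, $n\ge0$ and $0\le k\le n$, $$\left[{n\atop k}\right]_{C_m}=\left[{k+m\atop m}\right]_{R_{n+m-1}}=\left[{n\atop k}\right]_{R_{n+m-1}}.$$ That is, row $n$ of $\Delta(C_m)$ equals column $m$ of $\Delta(R_{n+m-1})$, which equals row $n$ of $\Delta(R_{n+m-1})$.
   Context: For a (finite or infinite) sequence $h=(h_1,h_2,\dots)$ of nonzero rational numbers and integers $0\le k\le n$ (with $n$ at most the length of $h$), $\left[{n\atop k}\right]_h=\dfrac{h_nh_{n-1}\cdots h_{n-k+1}}{h_kh_{k-1}\cdots h_1}$ (equal to $1$ for $k=0$). $\Delta(h)$ denotes the triangle of these numbers, row $n$ being $(\left[{n\atop k}\right]_h)_{0\le k\le n}$ and column $m$ being $(\left[{N+m-1\atop m}\right]_h)_{N\ge1}$. -}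

module Defs where

open import Data.Nat using (ℕ; zero; suc; _+_; _∸_)
open import Data.Integer using (ℤ)
open import Data.Rational using (ℚ; 0ℚ; 1ℚ; _*_; _÷_; _/_; ≢-nonZero)
open import Data.Rational.Properties using (_≟_)
open import Relation.Nullary using (yes; no)

-- Sequences are indexed from 1: a sequence h = (h_1, h_2, ...) is a function
-- ℕ → ℚ whose value at 0 is never used.

-- Division on ℚ, totalised by p / 0 = 0 (only ever applied to nonzero
-- denominators in the statement).
_÷'_ : ℚ → ℚ → ℚ
p ÷' q with q ≟ 0ℚ
... | yes _ = 0ℚ
... | no q≢0 = _÷_ p q {{≢-nonZero q≢0}}

prodFrom : (ℕ → ℚ) → ℕ → ℕ → ℚ
prodFrom h a zero = 1ℚ
prodFrom h a (suc k) = prodFrom h a k * h (a + suc k)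

gbin : (ℕ → ℚ) → ℕ → ℕ → ℚ
gbin h n k = prodFrom h (n ∸ k) k ÷' prodFrom h 0 k

toℚseq : (ℕ → ℤ) → ℕ → ℚ
toℚseq f i = f i / 1

colSeq : (ℕ → ℤ) → ℕ → ℕ → ℚ
colSeq f m N = gbin (toℚseq f) (N + m ∸ 1) m

-- row sequence R_M(N) = [M N-1]_f  (meaningful for 1 ≤ N ≤ M+1)
rowSeq : (ℕ → ℤ) → ℕ → ℕ → ℚ
rowSeq f M N = gbin (toℚseq f) M (N ∸ 1)

-- Write F j = f₁ ⋯ f_j and P j = f_{j+1} ⋯ f_{j+m}; for nonzero fᵢ,
-- [n k]_f · F k · F (n − k) = F n characterises the generalised binomial.
-- With R = R_{n+m−1}, the three rows k ↦ [n k]_{C_m}, k ↦ [k+m m]_R and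
-- k ↦ [n k]_R all start with 1 and have the same consecutive ratios
-- Q (k + 1) / Q k = P (n − 1 − k) / P k, so they agree on 0 ≤ k ≤ n.
-- The ratios come from the one-step identities
-- [n k+1]_h h_{k+1} = [n k]_h h_{n−k} and [j+1+m m]_h h_{j+1} = [j+m m]_h h_{j+1+m},
-- applied to h = C_m and h = R, combined with
-- [M k+m]_f P k = [M k]_f P (M − k − m) and the symmetry of [M k]_f.
module Submission where

open import Defs
open import Data.Nat using (ℕ; zero; suc; _+_; _∸_; _≤_; s≤s; z≤n)
open import Data.Nat.Properties
  using (+-comm; +-assoc; +-identityʳ; +-suc; <⇒≤; m+n∸m≡n; m+n∸n≡m; m+[n∸m]≡n)
open import Data.Integer using (ℤ) renaming (_*_ to _ℤ*_)
open import Data.Integer.Properties using () renaming (*-zeroˡ to ℤ-*-zeroˡ)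
open import Data.Integer.GCD using (gcd)
open import Data.Product using (_×_; _,_)
open import Data.Rational using (ℚ; 0ℚ; 1ℚ; _*_; _/_; 1/_; ↥_; ≢-nonZero)
open import Data.Rational.Properties
  using (_≟_; *-assoc; *-comm; *-identityʳ; *-identityˡ; *-inverseˡ; *-inverseʳ; *-zeroˡ;
         *-1-commutativeMonoid; ↥-/; p≡0⇒↥p≡0)
open import Algebra.Solver.CommutativeMonoid *-1-commutativeMonoid using (solve; _⊕_; _⊜_)
open import Relation.Binary.PropositionalEquality
  using (_≡_; _≢_; refl; sym; trans; cong; cong₂; subst; module ≡-Reasoning)
open import Relation.Nullary using (yes; no)
open import Data.Empty using (⊥-elim)

open ≡-Reasoning

*-cancelʳ : ∀ {a b c} → c ≢ 0ℚ → a * c ≡ b * c → a ≡ b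
*-cancelʳ {a} {b} {c} c≢0 eq = begin
  a                ≡⟨ sym (*-identityʳ a) ⟩
  a * 1ℚ           ≡⟨ cong (a *_) (sym (*-inverseʳ c)) ⟩
  a * (c * 1/ c)   ≡⟨ sym (*-assoc a c _) ⟩
  a * c * 1/ c     ≡⟨ cong (_* 1/ c) eq ⟩
  b * c * 1/ c     ≡⟨ *-assoc b c _ ⟩
  b * (c * 1/ c)   ≡⟨ cong (b *_) (*-inverseʳ c) ⟩
  b * 1ℚ           ≡⟨ *-identityʳ b ⟩
  b                ∎
  where instance _ = ≢-nonZero c≢0

*-≢0 : ∀ {p q} → p ≢ 0ℚ → q ≢ 0ℚ → p * q ≢ 0ℚ
*-≢0 {p} {q} p≢0 q≢0 pq≡0 =
  q≢0 (*-cancelʳ p≢0 (trans (*-comm q p) (trans pq≡0 (sym (*-zeroˡ p)))))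

÷'-*-cancelʳ : ∀ {p q} → q ≢ 0ℚ → (p ÷' q) * q ≡ p
÷'-*-cancelʳ {p} {q} q≢0 with q ≟ 0ℚ
... | yes q≡0  = ⊥-elim (q≢0 q≡0)
... | no  q≢0′ = begin
  p * 1/ q * q     ≡⟨ *-assoc p _ q ⟩
  p * (1/ q * q)   ≡⟨ cong (p *_) (*-inverseˡ q) ⟩
  p * 1ℚ           ≡⟨ *-identityʳ p ⟩
  p                ∎
  where instance _ = ≢-nonZero q≢0′

÷'-≢0 : ∀ {p q} → p ≢ 0ℚ → q ≢ 0ℚ → p ÷' q ≢ 0ℚ
÷'-≢0 {p} {q} p≢0 q≢0 p÷q≡0 =
  p≢0 (trans (sym (÷'-*-cancelʳ q≢0)) (trans (cong (_* q) p÷q≡0) (*-zeroˡ q)))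

xy∙z≡xz∙y : ∀ x y z → x * y * z ≡ x * z * y
xy∙z≡xz∙y = solve 3 (λ x y z → (x ⊕ y) ⊕ z ⊜ (x ⊕ z) ⊕ y) refl

-- From x / y = c₂ / c₁ = u / d, in cross-multiplied form.
*-cross-trans : ∀ x y c₁ c₂ d u → c₁ ≢ 0ℚ →
  x * c₁ ≡ y * c₂ → c₂ * d ≡ c₁ * u → x * d ≡ y * u
*-cross-trans x y c₁ c₂ d u c₁≢0 xc₁≡yc₂ c₂d≡c₁u = *-cancelʳ c₁≢0 (begin
  x * d * c₁     ≡⟨ xy∙z≡xz∙y x d c₁ ⟩
  x * c₁ * d     ≡⟨ cong (_* d) xc₁≡yc₂ ⟩
  y * c₂ * d     ≡⟨ *-assoc y c₂ d ⟩
  y * (c₂ * d)   ≡⟨ cong (y *_) c₂d≡c₁u ⟩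
  y * (c₁ * u)   ≡⟨ sym (*-assoc y c₁ u) ⟩
  y * c₁ * u     ≡⟨ xy∙z≡xz∙y y c₁ u ⟩
  y * u * c₁     ∎)

xy∙uv≡x∙uy∙v : ∀ x y u v → x * y * (u * v) ≡ x * (u * y * v)
xy∙uv≡x∙uy∙v = solve 4 (λ x y u v → (x ⊕ y) ⊕ (u ⊕ v) ⊜ x ⊕ ((u ⊕ y) ⊕ v)) refl

x∙u∙vy≡xy∙uv : ∀ x u v y → x * (u * (v * y)) ≡ x * y * (u * v)
x∙u∙vy≡xy∙uv = solve 4 (λ x u v y → x ⊕ (u ⊕ (v ⊕ y)) ⊜ (x ⊕ y) ⊕ (u ⊕ v)) refl

x∙uv∙y≡xy∙uv : ∀ x u v y → x * (u * v) * y ≡ x * y * (u * v)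
x∙uv∙y≡xy∙uv = solve 4 (λ x u v y → (x ⊕ (u ⊕ v)) ⊕ y ⊜ (x ⊕ y) ⊕ (u ⊕ v)) refl

NonZeroSeq : (ℕ → ℚ) → Set
NonZeroSeq h = ∀ i → 1 ≤ i → h i ≢ 0ℚ

prodFrom-+ : ∀ h a k j → prodFrom h a (k + j) ≡ prodFrom h a k * prodFrom h (a + k) j
prodFrom-+ h a k zero = trans (cong (prodFrom h a) (+-identityʳ k)) (sym (*-identityʳ _))
prodFrom-+ h a k (suc j) = begin
  prodFrom h a (k + suc j)
    ≡⟨ cong (prodFrom h a) (+-suc k j) ⟩
  prodFrom h a (k + j) * h (a + suc (k + j))
    ≡⟨ cong₂ _*_ (prodFrom-+ h a k j) (cong h index) ⟩
  prodFrom h a k * prodFrom h (a + k) j * h (a + k + suc j)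
    ≡⟨ *-assoc (prodFrom h a k) _ _ ⟩
  prodFrom h a k * prodFrom h (a + k) (suc j) ∎
  where
  index : a + suc (k + j) ≡ a + k + suc j
  index = trans (cong (a +_) (sym (+-suc k j))) (sym (+-assoc a k (suc j)))

prodFrom-≢0 : ∀ {h} → NonZeroSeq h → ∀ a k → prodFrom h a k ≢ 0ℚ
prodFrom-≢0 h≢0 a zero    = λ ()
prodFrom-≢0 h≢0 a (suc k) =
  *-≢0 (prodFrom-≢0 h≢0 a k) (h≢0 (a + suc k) (subst (1 ≤_) (sym (+-suc a k)) (s≤s z≤n)))

gfact : (ℕ → ℚ) → ℕ → ℚ
gfact h = prodFrom h 0

module _ {h : ℕ → ℚ} (h≢0 : NonZeroSeq h) where

  gfact-≢0 : ∀ n → gfact h n ≢ 0ℚ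
  gfact-≢0 = prodFrom-≢0 h≢0 0

  gfact²-≢0 : ∀ k a → gfact h k * gfact h a ≢ 0ℚ
  gfact²-≢0 k a = *-≢0 (gfact-≢0 k) (gfact-≢0 a)

  gbin-≢0 : ∀ n k → gbin h n k ≢ 0ℚ
  gbin-≢0 n k = ÷'-≢0 (prodFrom-≢0 h≢0 (n ∸ k) k) (gfact-≢0 k)

  gbin-gfact : ∀ {n} k a → k + a ≡ n → gbin h n k * (gfact h k * gfact h a) ≡ gfact h n
  gbin-gfact k a refl = begin
    gbin h (k + a) k * (gfact h k * gfact h a)
      ≡⟨ cong (λ b → (prodFrom h b k ÷' gfact h k) * (gfact h k * gfact h a)) (m+n∸m≡n k a) ⟩
    (prodFrom h a k ÷' gfact h k) * (gfact h k * gfact h a)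
      ≡⟨ sym (*-assoc (prodFrom h a k ÷' gfact h k) (gfact h k) (gfact h a)) ⟩
    (prodFrom h a k ÷' gfact h k) * gfact h k * gfact h a
      ≡⟨ cong (_* gfact h a) (÷'-*-cancelʳ (gfact-≢0 k)) ⟩
    prodFrom h a k * gfact h a
      ≡⟨ *-comm _ (gfact h a) ⟩
    gfact h a * prodFrom h a k
      ≡⟨ sym (prodFrom-+ h 0 a k) ⟩
    gfact h (a + k)
      ≡⟨ cong (gfact h) (+-comm a k) ⟩
    gfact h (k + a) ∎

  gbin-diag : ∀ n → gbin h n n ≡ 1ℚ
  gbin-diag n = *-cancelʳ (gfact²-≢0 n 0) (begin
    gbin h n n * (gfact h n * 1ℚ)   ≡⟨ gbin-gfact n 0 (+-identityʳ n) ⟩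
    gfact h n                       ≡⟨ sym (*-identityʳ _) ⟩
    gfact h n * 1ℚ                  ≡⟨ sym (*-identityˡ _) ⟩
    1ℚ * (gfact h n * 1ℚ)           ∎)

  gbin-sym : ∀ {n} k a → k + a ≡ n → gbin h n k ≡ gbin h n a
  gbin-sym {n} k a k+a≡n = *-cancelʳ (gfact²-≢0 k a) (begin
    gbin h n k * (gfact h k * gfact h a)
      ≡⟨ gbin-gfact k a k+a≡n ⟩
    gfact h n
      ≡⟨ sym (gbin-gfact a k (trans (+-comm a k) k+a≡n)) ⟩
    gbin h n a * (gfact h a * gfact h k)
      ≡⟨ cong (gbin h n a *_) (*-comm (gfact h a) (gfact h k)) ⟩
    gbin h n a * (gfact h k * gfact h a) ∎)

  gbin-step : ∀ {n} k a → suc k + a ≡ n → gbin h n (suc k) * h (suc k) ≡ gbin h n k * h (suc a)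
  gbin-step {n} k a e = *-cancelʳ (gfact²-≢0 k a) (begin
    gbin h n (suc k) * h (suc k) * (gfact h k * gfact h a)
      ≡⟨ xy∙uv≡x∙uy∙v (gbin h n (suc k)) (h (suc k)) (gfact h k) (gfact h a) ⟩
    gbin h n (suc k) * (gfact h (suc k) * gfact h a)
      ≡⟨ gbin-gfact (suc k) a e ⟩
    gfact h n
      ≡⟨ sym (gbin-gfact k (suc a) (trans (+-suc k a) e)) ⟩
    gbin h n k * (gfact h k * gfact h (suc a))
      ≡⟨ x∙u∙vy≡xy∙uv (gbin h n k) (gfact h k) (gfact h a) (h (suc a)) ⟩
    gbin h n k * h (suc a) * (gfact h k * gfact h a) ∎)

  gbin-column-step : ∀ j m → gbin h (suc j + m) m * h (suc j) ≡ gbin h (j + m) m * h (suc j + m)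
  gbin-column-step j m = *-cancelʳ (gfact²-≢0 m j) (begin
    gbin h (suc j + m) m * h (suc j) * (gfact h m * gfact h j)
      ≡⟨ sym (x∙u∙vy≡xy∙uv (gbin h (suc j + m) m) (gfact h m) (gfact h j) (h (suc j))) ⟩
    gbin h (suc j + m) m * (gfact h m * gfact h (suc j))
      ≡⟨ gbin-gfact m (suc j) (+-comm m (suc j)) ⟩
    gfact h (j + m) * h (suc j + m)
      ≡⟨ cong (_* h (suc j + m)) (sym (gbin-gfact m j (+-comm m j))) ⟩
    gbin h (j + m) m * (gfact h m * gfact h j) * h (suc j + m)
      ≡⟨ x∙uv∙y≡xy∙uv (gbin h (j + m) m) (gfact h m) (gfact h j) (h (suc j + m)) ⟩
    gbin h (j + m) m * h (suc j + m) * (gfact h m * gfact h j) ∎)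

  gbin-shift : ∀ {n} k m a → k + m + a ≡ n →
    gbin h n (k + m) * prodFrom h k m ≡ gbin h n k * prodFrom h a m
  gbin-shift {n} k m a e = *-cancelʳ (gfact²-≢0 k a) (begin
    gbin h n (k + m) * prodFrom h k m * (gfact h k * gfact h a)
      ≡⟨ xy∙uv≡x∙uy∙v (gbin h n (k + m)) (prodFrom h k m) (gfact h k) (gfact h a) ⟩
    gbin h n (k + m) * (gfact h k * prodFrom h k m * gfact h a)
      ≡⟨ cong (λ c → gbin h n (k + m) * (c * gfact h a)) (sym (prodFrom-+ h 0 k m)) ⟩
    gbin h n (k + m) * (gfact h (k + m) * gfact h a)
      ≡⟨ gbin-gfact (k + m) a e ⟩
    gfact h n
      ≡⟨ sym (gbin-gfact k (a + m) e′) ⟩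
    gbin h n k * (gfact h k * gfact h (a + m))
      ≡⟨ cong (λ c → gbin h n k * (gfact h k * c)) (prodFrom-+ h 0 a m) ⟩
    gbin h n k * (gfact h k * (gfact h a * prodFrom h a m))
      ≡⟨ x∙u∙vy≡xy∙uv (gbin h n k) (gfact h k) (gfact h a) (prodFrom h a m) ⟩
    gbin h n k * prodFrom h a m * (gfact h k * gfact h a) ∎)
    where
    e′ : k + (a + m) ≡ n
    e′ = trans (cong (k +_) (+-comm a m)) (trans (sym (+-assoc k m a)) e)

RowRatios : ℕ → (ℕ → ℚ) → (ℕ → ℚ) → Set
RowRatios n p Q = ∀ k a → suc k + a ≡ n → Q (suc k) * p k ≡ Q k * p a

RowRatios-unique : ∀ {n p} Q Q′ → (∀ j → p j ≢ 0ℚ) →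
  RowRatios n p Q → RowRatios n p Q′ → Q 0 ≡ Q′ 0 → ∀ {k} → k ≤ n → Q k ≡ Q′ k
RowRatios-unique Q Q′ p≢0 ratQ ratQ′ Q₀≡Q′₀ {zero}  _   = Q₀≡Q′₀
RowRatios-unique {n} {p} Q Q′ p≢0 ratQ ratQ′ Q₀≡Q′₀ {suc k} k<n = *-cancelʳ (p≢0 k) (begin
  Q (suc k) * p k    ≡⟨ ratQ k a e ⟩
  Q k * p a          ≡⟨ cong (_* p a) IH ⟩
  Q′ k * p a         ≡⟨ sym (ratQ′ k a e) ⟩
  Q′ (suc k) * p k   ∎)
  where
  a = n ∸ suc k
  e = m+[n∸m]≡n k<n
  IH = RowRatios-unique Q Q′ p≢0 ratQ ratQ′ Q₀≡Q′₀ (<⇒≤ k<n)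

toℚseq-≢0 : ∀ {f} → (∀ i → 1 ≤ i → f i ≢ ℤ.pos 0) → NonZeroSeq (toℚseq f)
toℚseq-≢0 {f} f≢0 i i≥1 fᵢ/1≡0 = f≢0 i i≥1 (begin
  f i                 ≡⟨ sym (↥-/ (f i) 1) ⟩
  ↥ (f i / 1) ℤ* g    ≡⟨ cong (_ℤ* g) (p≡0⇒↥p≡0 (f i / 1) fᵢ/1≡0) ⟩
  ℤ.pos 0 ℤ* g        ≡⟨ ℤ-*-zeroˡ g ⟩
  ℤ.pos 0             ∎)
  where g = gcd (f i) (ℤ.pos 1)

module _ {f : ℕ → ℤ} (f≢0 : ∀ i → 1 ≤ i → f i ≢ ℤ.pos 0) (m : ℕ) where

  private
    fℚ : ℕ → ℚ
    fℚ = toℚseq f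

    fℚ≢0 : NonZeroSeq fℚ
    fℚ≢0 = toℚseq-≢0 f≢0

    p : ℕ → ℚ
    p j = prodFrom fℚ j m

  colSeq-≢0 : NonZeroSeq (colSeq f m)
  colSeq-≢0 i _ = gbin-≢0 fℚ≢0 (i + m ∸ 1) m

  rowSeq-≢0 : ∀ M → NonZeroSeq (rowSeq f M)
  rowSeq-≢0 M i _ = gbin-≢0 fℚ≢0 M (i ∸ 1)

  colSeq-suc : ∀ j → colSeq f m (suc j) * gfact fℚ m ≡ p j
  colSeq-suc j = trans (cong (λ b → (prodFrom fℚ b m ÷' gfact fℚ m) * gfact fℚ m) (m+n∸n≡m j m))
                       (÷'-*-cancelʳ (gfact-≢0 fℚ≢0 m))

  colSeq-ratio : ∀ k a → colSeq f m (suc a) * p k ≡ colSeq f m (suc k) * p a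
  colSeq-ratio k a = *-cancelʳ (gfact-≢0 fℚ≢0 m) (begin
    C (suc a) * p k * gfact fℚ m   ≡⟨ xy∙z≡xz∙y (C (suc a)) (p k) (gfact fℚ m) ⟩
    C (suc a) * gfact fℚ m * p k   ≡⟨ cong (_* p k) (colSeq-suc a) ⟩
    p a * p k                      ≡⟨ *-comm (p a) (p k) ⟩
    p k * p a                      ≡⟨ cong (_* p a) (sym (colSeq-suc k)) ⟩
    C (suc k) * gfact fℚ m * p a   ≡⟨ xy∙z≡xz∙y (C (suc k)) (gfact fℚ m) (p a) ⟩
    C (suc k) * p a * gfact fℚ m   ∎)
    where C = colSeq f m

  rowSeq-shift : ∀ k a →
    rowSeq f (k + a + m) (suc k + m) * p k ≡ rowSeq f (k + a + m) (suc k) * p a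
  rowSeq-shift k a = gbin-shift fℚ≢0 k m a index
    where
    index : k + m + a ≡ k + a + m
    index = trans (+-assoc k m a) (trans (cong (k +_) (+-comm m a)) (sym (+-assoc k a m)))

  colSeq-row-ratios : ∀ {n} → RowRatios n p (gbin (colSeq f m) n)
  colSeq-row-ratios {n} k a e =
    *-cross-trans (A (suc k)) (A k) (C (suc k)) (C (suc a)) (p k) (p a)
      (colSeq-≢0 (suc k) (s≤s z≤n)) (gbin-step colSeq-≢0 k a e) (colSeq-ratio k a)
    where
    C = colSeq f m
    A = gbin C n

  rowSeq-column-ratios : ∀ {n} → RowRatios n p (λ j → gbin (rowSeq f (n + m ∸ 1)) (j + m) m)
  rowSeq-column-ratios k a refl =
    *-cross-trans (B (suc k)) (B k) (R (suc k)) (R (suc k + m)) (p k) (p a)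
      (rowSeq-≢0 _ (suc k) (s≤s z≤n)) (gbin-column-step (rowSeq-≢0 _) k m) (rowSeq-shift k a)
    where
    R = rowSeq f (k + a + m)
    B = λ j → gbin R (j + m) m

  rowSeq-row-ratios : ∀ {n} → RowRatios n p (gbin (rowSeq f (n + m ∸ 1)) n)
  rowSeq-row-ratios k a refl =
    *-cross-trans (D (suc k)) (D k) (R (suc k)) (R (suc a)) (p k) (p a)
      (rowSeq-≢0 _ (suc k) (s≤s z≤n)) (gbin-step (rowSeq-≢0 _) k a refl)
      (trans (cong (_* p k) (gbin-sym fℚ≢0 a (k + m) index)) (rowSeq-shift k a))
    where
    R = rowSeq f (k + a + m)
    D = gbin R (suc k + a)
    index : a + (k + m) ≡ k + a + m
    index = trans (sym (+-assoc a k m)) (cong (_+ m) (+-comm a k))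

proposition2p3 : (f : ℕ → ℤ) → (∀ i → 1 ≤ i → f i ≢ ℤ.pos 0) → f 1 ≡ ℤ.pos 1 →
    ∀ (m n k : ℕ) → 1 ≤ m → k ≤ n →
      (gbin (colSeq f m) n k ≡ gbin (rowSeq f (n + m ∸ 1)) (k + m) m)
      × (gbin (rowSeq f (n + m ∸ 1)) (k + m) m ≡ gbin (rowSeq f (n + m ∸ 1)) n k)
proposition2p3 f f≢0 _ m n k _ k≤n =
    RowRatios-unique A B p≢0 (colSeq-row-ratios f≢0 m) (rowSeq-column-ratios f≢0 m) (sym diag) k≤n
  , RowRatios-unique B D p≢0 (rowSeq-column-ratios f≢0 m) (rowSeq-row-ratios f≢0 m) diag k≤n
  where
  R = rowSeq f (n + m ∸ 1)
  A B D : ℕ → ℚ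
  A j = gbin (colSeq f m) n j
  B j = gbin R (j + m) m
  D j = gbin R n j
  p≢0 : ∀ j → prodFrom (toℚseq f) j m ≢ 0ℚ
  p≢0 j = prodFrom-≢0 (toℚseq-≢0 f≢0) j m
  diag : B 0 ≡ 1ℚ
  diag = gbin-diag (rowSeq-≢0 f≢0 m (n + m ∸ 1)) m
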